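{- Let $\mathcal{C} = \{c_{1}<c_2< \cdots< c_{n}< \cdots \}$ be an infinite completely greedy coin set. Write $c_{n+1} = q_{n} c_{n} + r_{n}$ with $q_n\in\mathbb{N}$, $0\le r_n<c_n$ (division algorithm), let $a_{n} = \lceil c_{n+1}/c_{n} \rceil$, let $b_{1} = a_{1} = q_{1}$ and for $n \ge 2$ let $b_{n} = a_{n}$ if $q_{n} \le s_{n-1}$ and $b_n=q_{n}$ otherwise, where $s_{n} = \sum_{k=1}^{n} (b_{k} - 1)$. Then \[ \mathrm{cost}(c_{n+1} -1 \, ; \, \mathcal{C} ) \ge \frac{s_{n}}{2} c_{n+1} + o(n c_{n+1}) \quad (n\to\infty), \] i.e. there is a function $e(n)$ with $e(n)/(n c_{n+1})\to 0$ such that $\mathrm{cost}(c_{n+1} -1 ; \mathcal{C} ) \ge \frac{s_{n}}{2} c_{n+1} + e(n)$ for all $n$. Moreover, $s_{n} \ge \max \{ n, \log_{2} c_{n+1} -1 \}$ for all $n$.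
   Context: A coin set is a set of positive integers containing $1$; a sub-coin set is a subset containing $1$. A representation of a positive integer $m$ in $\mathcal{C}$ is $m=\sum_{c\in\mathcal{C}}\alpha_c c$ with $\alpha_c\in\mathbb{N}$; it is minimal if $\sum_c\alpha_c$ is minimized. The greedy representation repeatedly subtracts the largest coin not exceeding the remaining amount. A finite coin set is greedy if the greedy representation is minimal for every positive integer, and completely greedy if all its sub-coin sets are greedy. An infinite coin set is completely greedy if for every finite $n$ its first $n$ elements form a completely greedy coin set. $\mathrm{opt}(k;\mathcal{C})$ is the number of coins in a minimal representation of $k$, and $\mathrm{cost}(N;\mathcal{C}) := \sum_{k=1}^{N} \mathrm{opt}(k;\mathcal{C})$, with $\mathrm{cost}(0;\mathcal{C}):=0$. -}

module Defs where

open import Data.Nat using (ℕ; zero; suc; _+_; _*_; _∸_; _≤_; _<_; _≤ᵇ_; _≡ᵇ_; _⊔_; pred)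
open import Data.Nat.DivMod using (_/_)
open import Data.Bool using (Bool; true; false; if_then_else_; _∧_)
open import Data.List using (List; []; _∷_; map; upTo; filter; foldr; sum; length)
open import Data.Bool.ListAction using (any)
open import Data.Product using (_×_)
open import Data.List.Membership.Propositional using (_∈_)
open import Data.List.Relation.Binary.Sublist.Propositional using (_⊆_)
open import Data.Nat.Properties using (_≤?_)
open import Relation.Binary.PropositionalEquality using (_≡_)

Reachable : List ℕ → ℕ → ℕ → Bool
Reachable cs zero    m = m ≡ᵇ 0
Reachable cs (suc k) m = any (λ c → (c ≤ᵇ m) ∧ Reachable cs k (m ∸ c)) cs

-- least k ≤ bound with p k = true (bound if none)
leastUpTo : (ℕ → Bool) → ℕ → ℕ
leastUpTo p bound = go bound 0
  where
  go : ℕ → ℕ → ℕ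
  go zero      k = k
  go (suc f)   k = if p k then k else go f (suc k)

-- opt(m; cs): number of coins in a minimal representation of m.
-- (Since 1 ∈ cs, m itself is always achievable, so the search up to m
--  finds the true minimum.)
opt : List ℕ → ℕ → ℕ
opt cs m = leastUpTo (λ k → Reachable cs k m) m

largestLE : List ℕ → ℕ → ℕ
largestLE cs m = foldr _⊔_ 0 (filter (_≤? m) cs)

-- number of coins in the greedy representation (fuel-bounded; fuel m
-- suffices as every coin is ≥ 1 and 1 ∈ cs)
greedyAux : ℕ → List ℕ → ℕ → ℕ
greedyAux zero    cs m       = 0
greedyAux (suc f) cs zero    = 0
greedyAux (suc f) cs (suc m) = suc (greedyAux f cs (suc m ∸ largestLE cs (suc m)))

greedyCount : List ℕ → ℕ → ℕ
greedyCount cs m = greedyAux m cs m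

Greedy : List ℕ → Set
Greedy cs = ∀ m → 1 ≤ m → greedyCount cs m ≡ opt cs m

CompletelyGreedy : List ℕ → Set
CompletelyGreedy cs = ∀ ds → ds ⊆ cs → 1 ∈ ds → Greedy ds

-- Infinite coin sets: c : ℕ → ℕ, 0-indexed in Agda; the paper's c_k is
-- C c k = c (k ∸ 1) for k ≥ 1.

C : (ℕ → ℕ) → ℕ → ℕ
C c k = c (k ∸ 1)

firstN : (ℕ → ℕ) → ℕ → List ℕ
firstN c n = map c (upTo n)

InfiniteCoinSet : (ℕ → ℕ) → Set
InfiniteCoinSet c = (c 0 ≡ 1) × (∀ i → c i < c (suc i))

InfCompletelyGreedy : (ℕ → ℕ) → Set
InfCompletelyGreedy c = ∀ n → CompletelyGreedy (firstN c n)

-- opt(k; C) for the infinite coin set: only coins ≤ k can occur, and all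
-- of them lie among the first k+1 coins (c_j ≥ j for strictly increasing c
-- with c_1 = 1).
optInf : (ℕ → ℕ) → ℕ → ℕ
optInf c k = opt (firstN c (suc k)) k

cost : (ℕ → ℕ) → ℕ → ℕ
cost c zero    = 0
cost c (suc N) = cost c N + optInf c (suc N)

divN : ℕ → ℕ → ℕ
divN m zero    = 0
divN m (suc d) = m / suc d

ceilDivN : ℕ → ℕ → ℕ
ceilDivN m zero    = 0
ceilDivN m (suc d) = (m + d) / suc d

q : (ℕ → ℕ) → ℕ → ℕ
q c n = divN (C c (suc n)) (C c n)

a : (ℕ → ℕ) → ℕ → ℕ
a c n = ceilDivN (C c (suc n)) (C c n)

mutual
  -- b_1 = q_1; b_n = a_n if q_n ≤ s_{n-1}, else q_n  (n ≥ 2); b_0 unused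
  b : (ℕ → ℕ) → ℕ → ℕ
  b c zero          = 0
  b c (suc zero)    = q c 1
  b c (suc (suc n)) = if q c (suc (suc n)) ≤ᵇ s c (suc n)
                        then a c (suc (suc n)) else q c (suc (suc n))

  s : (ℕ → ℕ) → ℕ → ℕ
  s c zero    = 0
  s c (suc n) = s c n + (b c (suc n) ∸ 1)

{-# OPTIONS --safe #-}
-- In the paper's indexing (Agda's c i is c_{i+1}) let g_n(m) be the greedy count of m with the coins
-- c_1, …, c_n and G_n = Σ_{m < c_{n+1}} g_n(m). Complete greediness makes optimal counts greedy, so
-- G_n = cost(c_{n+1} − 1), and e(n) = −E_n/2 works once the deficit E_n = max(0, s_n c_{n+1} − 2 G_n)
-- is shown to be o(n c_{n+1}).
-- Write c_{n+2} = q c_{n+1} + r. Cutting [0, c_{n+2}) into q blocks of length c_{n+1} and a tail of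
-- length r gives G_{n+1} = q(q − 1)/2 · c_{n+1} + q G_n + r q + Σ_{u<r} g_n(u). If b_{n+1} = q this
-- yields E_{n+1} ≤ q E_n; if b_{n+1} = q + 1 (r > 0 and q ≤ s_n) it yields
-- E_{n+1} ≤ (q + 1) E_n + 2 (c_{n+1} − r) Q_n, where Q_n = q_1 + ⋯ + q_n bounds every g_n(u) with
-- u < c_{n+1}, and c_{n+1} − r ≤ q because the sub-coin set {1, c_{n+1}, c_{n+2}} is greedy at
-- (q + 1) c_{n+1}. In both cases E_{n+1}/c_{n+2} ≤ E_n/c_{n+1} + 3 Q_n/c_{n+1}. The same three-coin
-- sets give c_{n+1} ≥ 2 c_n − 1, so Q_n/c_{n+1} = O(n/2^n) is summable and in fact E_n = O(c_{n+1}).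
-- The bounds on s_n are inductions on b_n ≥ 2 and c_{n+1} ≤ 2^{b_n − 1} c_n; the only exception to the
-- latter, b_n = q_n = 2, forces n = 2 and c_2 = 2.
module Submission where

open import Defs
open import Data.Bool using (Bool; true; false; T)
import Data.Bool.Properties as Bool
open import Data.Bool.Properties using (¬-not; T-≡; T-∧)
open import Data.Empty using (⊥-elim)
open import Data.List using ([]; _∷_; applyUpTo)
open import Data.List.Properties using (foldr-preservesᵇ; foldr-preservesᵒ; map-upTo)
import Data.List.Relation.Unary.All as All
import Data.List.Relation.Unary.Any as Any
open import Data.List.Relation.Unary.Any using (here; there)
open import Data.List.Relation.Unary.Any.Properties using (any⁺)
open import Data.List.Membership.Propositional using (_∈_)
open import Data.List.Membership.Propositional.Properties using (∈-filter⁺; ∈-filter⁻; ∈-map⁺; ∈-map⁻; ∈-upTo⁺; ∈-upTo⁻)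
open import Data.List.Relation.Binary.Sublist.Propositional using (_⊆_; ⊆-refl)
open import Data.List.Relation.Binary.Sublist.Heterogeneous using (_∷ʳ_) renaming ([] to []ˢ; _∷_ to _∷ˢ_)
open import Data.Nat
open import Data.Nat.Properties
open import Data.Nat.DivMod
open import Data.Nat.Divisibility using (divides-refl)
open import Data.Nat.Logarithm using (⌈log₂_⌉; ⌈log₂⌉-mono-≤; ⌈log₂2^n⌉≡n)
open import Data.Nat.Tactic.RingSolver using (solve-∀)
open import Data.Product using (Σ; _×_; _,_)
open import Data.Sum using (_⊎_; inj₁; inj₂; [_,_])
open import Function using (_∘_)
open import Function.Bundles using (Equivalence)
open import Relation.Nullary using (yes; no)
open import Relation.Binary.PropositionalEquality hiding ([_])
open import Data.Integer using (+_)
import Data.Integer as ℤ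
import Data.Integer.Properties as ℤ
import Data.Integer.Tactic.RingSolver as ℤ-Solver
import Data.Rational.Unnormalised as Q

-- Division with remainder

modN : ℕ → ℕ → ℕ
modN m zero    = m
modN m (suc d) = m % suc d

divN-modN : ∀ m {k} → 0 < k → m ≡ divN m k * k + modN m k
divN-modN m {suc d} _ = trans (m≡m%n+[m/n]*n m (suc d)) (+-comm (m % suc d) _)

modN< : ∀ m {k} → 0 < k → modN m k < k
modN< m {suc d} _ = m%n<n m (suc d)

divN-unique : ∀ j {k u} → u < k → divN (j * k + u) k ≡ j
divN-unique j {suc d} {u} u<k = begin
  (j * suc d + u) / suc d         ≡⟨ +-distrib-/-∣ˡ u (divides-refl j) ⟩
  j * suc d / suc d + u / suc d   ≡⟨ cong₂ _+_ (m*n/n≡m j (suc d)) (m<n⇒m/n≡0 u<k) ⟩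
  j + 0                           ≡⟨ +-identityʳ j ⟩
  j                               ∎
  where open ≡-Reasoning

modN-unique : ∀ j {k u} → u < k → modN (j * k + u) k ≡ u
modN-unique j {suc d} u<k = trans (%-remove-+ˡ _ (divides-refl j)) (m<n⇒m%n≡m u<k)

divN-monoˡ-≤ : ∀ k {m n} → m ≤ n → divN m k ≤ divN n k
divN-monoˡ-≤ zero    _   = z≤n
divN-monoˡ-≤ (suc d) m≤n = /-monoˡ-≤ (suc d) m≤n

divN-∸ : ∀ {m k} → 0 < k → k ≤ m → divN m k ≡ suc (divN (m ∸ k) k)
divN-∸ {k = suc d} _ k≤m = m/n≡1+[m∸n]/n k≤m

modN-∸ : ∀ {m k} → k ≤ m → modN (m ∸ k) k ≡ modN m k
modN-∸ {k = zero}  _   = refl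
modN-∸ {k = suc d} k≤m = m≤n⇒[n∸m]%m≡n%m k≤m

ceilDivN-exact : ∀ j {k} → 0 < k → ceilDivN (j * k) k ≡ j
ceilDivN-exact j {suc d} _ = divN-unique j {suc d} ≤-refl

ceilDivN-inexact : ∀ j {k u} → 0 < u → u < k → ceilDivN (j * k + u) k ≡ suc j
ceilDivN-inexact j {suc d} {suc u} _ u<k =
  trans (cong (_/ suc d) (shift j u d)) (divN-unique (suc j) {suc d} (<-trans (n<1+n u) u<k))
  where
  shift : ∀ j u d → j * suc d + suc u + d ≡ suc j * suc d + u
  shift = solve-∀

-- Finite sums and powers of two

∑ : ℕ → (ℕ → ℕ) → ℕ
∑ zero    f = 0
∑ (suc n) f = ∑ n f + f n

-- The body binds like an argument: ∑[ k < j ] k * x means (∑[ k < j ] k) * x.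
syntax ∑ n (λ u → e) = ∑[ u < n ] e

∑-+ : ∀ a b f → ∑ (a + b) f ≡ ∑ a f + ∑[ u < b ] f (a + u)
∑-+ a zero    f = trans (cong (λ n → ∑ n f) (+-identityʳ a)) (sym (+-identityʳ _))
∑-+ a (suc b) f = begin
  ∑ (a + suc b) f                           ≡⟨ cong (λ n → ∑ n f) (+-suc a b) ⟩
  ∑ (a + b) f + f (a + b)                   ≡⟨ cong (_+ f (a + b)) (∑-+ a b f) ⟩
  ∑ a f + ∑[ u < b ] f (a + u) + f (a + b)  ≡⟨ +-assoc (∑ a f) _ _ ⟩
  ∑ a f + ∑[ u < suc b ] f (a + u)          ∎
  where open ≡-Reasoning

∑-cong : ∀ n {f h} → (∀ {u} → u < n → f u ≡ h u) → ∑ n f ≡ ∑ n h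
∑-cong zero    eq = refl
∑-cong (suc n) eq = cong₂ _+_ (∑-cong n (λ u<n → eq (m<n⇒m<1+n u<n))) (eq (n<1+n n))

∑-mono-≤ : ∀ n {f h} → (∀ {u} → u < n → f u ≤ h u) → ∑ n f ≤ ∑ n h
∑-mono-≤ zero    le = z≤n
∑-mono-≤ (suc n) le = +-mono-≤ (∑-mono-≤ n (λ u<n → le (m<n⇒m<1+n u<n))) (le (n<1+n n))

∑-const : ∀ n k → ∑[ _ < n ] k ≡ n * k
∑-const zero    k = refl
∑-const (suc n) k = trans (cong (_+ k) (∑-const n k)) (+-comm (n * k) k)

∑-const-+ : ∀ n k f → ∑[ u < n ] (k + f u) ≡ n * k + ∑ n f
∑-const-+ zero    k f = refl
∑-const-+ (suc n) k f = begin
  ∑[ u < n ] (k + f u) + (k + f n)  ≡⟨ cong (_+ (k + f n)) (∑-const-+ n k f) ⟩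
  n * k + ∑ n f + (k + f n)         ≡⟨ shuffle (n * k) (∑ n f) k (f n) ⟩
  (k + n * k) + (∑ n f + f n)       ∎
  where
  open ≡-Reasoning
  shuffle : ∀ x y z w → x + y + (z + w) ≡ (z + x) + (y + w)
  shuffle = solve-∀

double-∑-id : ∀ n → 2 * ∑[ j < n ] j ≡ n * (n ∸ 1)
double-∑-id zero          = refl
double-∑-id (suc zero)    = refl
double-∑-id (suc (suc n)) = begin
  2 * (∑[ j < suc n ] j + suc n)   ≡⟨ *-distribˡ-+ 2 (∑[ j < suc n ] j) (suc n) ⟩
  2 * ∑[ j < suc n ] j + 2 * suc n ≡⟨ cong (_+ 2 * suc n) (double-∑-id (suc n)) ⟩
  suc n * n + 2 * suc n            ≡⟨ step n ⟩
  suc (suc n) * suc n              ∎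
  where
  open ≡-Reasoning
  step : ∀ n → suc n * n + 2 * suc n ≡ suc (suc n) * suc n
  step = solve-∀

n<2^n : ∀ n → n < 2 ^ n
n<2^n zero    = s≤s z≤n
n<2^n (suc n) = begin-strict
  suc n          ≡⟨ +-comm 1 n ⟩
  n + 1          <⟨ +-mono-<-≤ (n<2^n n) (m^n>0 2 n) ⟩
  2 ^ n + 2 ^ n  ≡⟨ cong (_+_ (2 ^ n)) (sym (+-identityʳ (2 ^ n))) ⟩
  2 ^ suc n      ∎
  where open ≤-Reasoning

2*n≤2^n : ∀ n → 2 * n ≤ 2 ^ n
2*n≤2^n zero    = z≤n
2*n≤2^n (suc n) = *-monoʳ-≤ 2 (n<2^n n)

n≤2^[n∸1] : ∀ n → n ≤ 2 ^ (n ∸ 1)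
n≤2^[n∸1] zero    = z≤n
n≤2^[n∸1] (suc n) = n<2^n n

1+n≤2^[n∸1] : ∀ {n} → 3 ≤ n → suc n ≤ 2 ^ (n ∸ 1)
1+n≤2^[n∸1] {suc (suc (suc n))} (s≤s (s≤s (s≤s _))) = begin
  4 + n        ≤⟨ +-monoʳ-≤ 4 (m≤m+n n n) ⟩
  4 + (n + n)  ≡⟨ double n ⟩
  2 * (2 + n)  ≤⟨ 2*n≤2^n (2 + n) ⟩
  2 ^ (2 + n)  ∎
  where
  open ≤-Reasoning
  double : ∀ m → 4 + (m + m) ≡ 2 * (2 + m)
  double = solve-∀

2^-shift : ∀ x y → 2 ^ x * 2 ^ suc y ≡ 2 ^ suc (y + x)
2^-shift x y = trans (sym (^-distribˡ-+-* 2 x (suc y))) (cong (2 ^_) (trans (+-suc x y) (cong suc (+-comm x y))))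

-- Greedy and optimal representations in a finite coin list

-- Defs hides the worker of leastUpTo in a where block; the hole is filled, and the worker thereby
-- named, by unification in leastUpTo-unfold.
mutual
  leastUpTo-go : (ℕ → Bool) → ℕ → ℕ → ℕ → ℕ
  leastUpTo-go p b = _

  leastUpTo-unfold : ∀ p b → p 0 ≡ false → leastUpTo p (suc b) ≡ leastUpTo-go p (suc b) b 1
  leastUpTo-unfold p b p0 with p 0
  ... | false with suc b | 1
  ...   | B | k = refl

leastUpTo-go-≤ : ∀ p b f k {K} → p K ≡ true → k ≤ K → K ≤ k + f → leastUpTo-go p b f k ≤ K
leastUpTo-go-≤ p b zero    k pK k≤K K≤k+f = k≤K
leastUpTo-go-≤ p b (suc f) k {K} pK k≤K K≤k+f with p k in pk
... | true  = k≤K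
... | false with m≤n⇒m<n∨m≡n k≤K
...   | inj₁ k<K  = leastUpTo-go-≤ p b f (suc k) pK k<K (subst (K ≤_) (+-suc k f) K≤k+f)
...   | inj₂ refl with () ← trans (sym pk) pK

leastUpTo-≤ : ∀ p b {K} → p K ≡ true → K ≤ b → leastUpTo p b ≤ K
leastUpTo-≤ p zero    pK K≤b = z≤n
leastUpTo-≤ p (suc b) {K} pK K≤b with p 0 Bool.≟ true
... | yes p0 rewrite p0 = z≤n
... | no ¬p0 = subst (_≤ K) (sym (leastUpTo-unfold p b (¬-not ¬p0)))
                 (leastUpTo-go-≤ p (suc b) b 1 pK (1≤K K pK) K≤b)
  where
  1≤K : ∀ K → p K ≡ true → 1 ≤ K
  1≤K zero    pK = ⊥-elim (¬p0 pK)
  1≤K (suc K) _  = s≤s z≤n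

largestLE-≡ : ∀ cs m {v} → v ∈ cs → v ≤ m → (∀ {y} → y ∈ cs → y ≤ m → y ≤ v) → largestLE cs m ≡ v
largestLE-≡ cs m {v} v∈cs v≤m maximal = ≤-antisym
  (foldr-preservesᵇ {P = _≤ v} ⊔-lub z≤n (All.tabulate (λ y∈ → let y∈cs , y≤m = ∈-filter⁻ (_≤? m) y∈ in maximal y∈cs y≤m)))
  (foldr-preservesᵒ {P = v ≤_} (λ x y → [ m≤n⇒m≤n⊔o y , m≤n⇒m≤o⊔n x ]) 0 _
    (inj₂ (Any.map ≤-reflexive (∈-filter⁺ (_≤? m) v∈cs v≤m))))

greedyAux-step : ∀ cs {f m} → 1 ≤ f → 1 ≤ m → greedyAux f cs m ≡ suc (greedyAux (f ∸ 1) cs (m ∸ largestLE cs m))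
greedyAux-step cs {suc f} {suc m} _ _ = refl

greedyAux-ones : ∀ cs f {x} → (∀ {y} → 1 ≤ y → y ≤ x → largestLE cs y ≡ 1) → x ≤ f → greedyAux f cs x ≡ x
greedyAux-ones cs zero    {zero}  _    _         = refl
greedyAux-ones cs (suc f) {zero}  _    _         = refl
greedyAux-ones cs (suc f) {suc x} ones (s≤s x≤f) rewrite ones (s≤s z≤n) ≤-refl =
  cong suc (greedyAux-ones cs f (λ 1≤y y≤x → ones 1≤y (m≤n⇒m≤1+n y≤x)) x≤f)

Reachable-step : ∀ cs {k m x} → x ∈ cs → x ≤ m → T (Reachable cs k (m ∸ x)) → T (Reachable cs (suc k) m)
Reachable-step cs x∈cs x≤m reach = any⁺ _ (Any.map (λ { refl → Equivalence.from T-∧ (≤⇒≤ᵇ x≤m , reach) }) x∈cs)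

Reachable-multiple : ∀ cs {x} → x ∈ cs → ∀ k → T (Reachable cs k (k * x))
Reachable-multiple cs x∈cs zero        = _
Reachable-multiple cs {x} x∈cs (suc k) = Reachable-step cs {k} x∈cs (m≤m+n x (k * x))
  (subst (T ∘ Reachable cs k) (sym (m+n∸m≡n x (k * x))) (Reachable-multiple cs x∈cs k))

opt-multiple : ∀ cs {x} → x ∈ cs → 0 < x → ∀ k → opt cs (k * x) ≤ k
opt-multiple cs {x} x∈cs x>0 k = leastUpTo-≤ _ (k * x) (Equivalence.to T-≡ (Reachable-multiple cs x∈cs k))
  (m≤m*n k x ⦃ >-nonZero x>0 ⦄)

adjacent⊆applyUpTo : ∀ {A : Set} (h : ℕ → A) i → h i ∷ h (suc i) ∷ [] ⊆ applyUpTo h (2 + i)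
adjacent⊆applyUpTo h zero    = refl ∷ˢ (refl ∷ˢ []ˢ)
adjacent⊆applyUpTo h (suc i) = h 0 ∷ʳ adjacent⊆applyUpTo (h ∘ suc) i

-- At m = (q + 1) x greedy takes y and then x − r ones, while q + 1 coins x suffice.
three-coin-greedy : ∀ {x y q r} → 1 < x → x < y → y ≡ q * x + r → 0 < r → r < x →
                    Greedy (1 ∷ x ∷ y ∷ []) → x ∸ r ≤ q
three-coin-greedy {x} {q = q} {r} 1<x x<y refl r>0 r<x greedy = s≤s⁻¹ (begin
  suc (x ∸ r)          ≡⟨ greedy-count ⟨
  greedyCount coins m  ≡⟨ greedy m 1≤m ⟩
  opt coins m          ≤⟨ opt-multiple coins (there (here refl)) (<-trans (s≤s z≤n) 1<x) (suc q) ⟩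
  suc q                ∎)
  where
  open ≤-Reasoning
  y = q * x + r
  coins = 1 ∷ x ∷ y ∷ []
  m = suc q * x
  1≤m : 1 ≤ m
  1≤m = ≤-trans (<⇒≤ 1<x) (m≤m+n x (q * x))
  y≤m : y ≤ m
  y≤m = subst (y ≤_) (+-comm (q * x) x) (+-monoʳ-≤ (q * x) (<⇒≤ r<x))
  m∸y≡x∸r : m ∸ y ≡ x ∸ r
  m∸y≡x∸r = trans (cong (_∸ y) (+-comm x (q * x))) ([m+n]∸[m+o]≡n∸o (q * x) x r)
  y-largest : largestLE coins m ≡ y
  y-largest = largestLE-≡ coins m (there (there (here refl))) y≤m maximal
    where
    maximal : ∀ {z} → z ∈ coins → z ≤ m → z ≤ y
    maximal (here refl)                 _ = <⇒≤ (<-trans 1<x x<y)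
    maximal (there (here refl))         _ = <⇒≤ x<y
    maximal (there (there (here refl))) _ = ≤-refl
  1-largest : ∀ {z} → 1 ≤ z → z ≤ x ∸ r → largestLE coins z ≡ 1
  1-largest {z} 1≤z z≤x∸r = largestLE-≡ coins z (here refl) 1≤z maximal
    where
    z<x : z < x
    z<x = ≤-<-trans z≤x∸r (∸-monoʳ-< r>0 (<⇒≤ r<x))
    maximal : ∀ {w} → w ∈ coins → w ≤ z → w ≤ 1
    maximal (here refl)                 _   = ≤-refl
    maximal (there (here refl))         x≤z = ⊥-elim (<⇒≱ z<x x≤z)
    maximal (there (there (here refl))) y≤z = ⊥-elim (<⇒≱ (<-trans z<x x<y) y≤z)
  greedy-count : greedyCount coins m ≡ suc (x ∸ r)
  greedy-count = begin-equality
    greedyAux m coins m                                 ≡⟨ greedyAux-step coins 1≤m 1≤m ⟩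
    suc (greedyAux (m ∸ 1) coins (m ∸ largestLE coins m)) ≡⟨ cong (λ v → suc (greedyAux (m ∸ 1) coins (m ∸ v))) y-largest ⟩
    suc (greedyAux (m ∸ 1) coins (m ∸ y))               ≡⟨ cong (λ v → suc (greedyAux (m ∸ 1) coins v)) m∸y≡x∸r ⟩
    suc (greedyAux (m ∸ 1) coins (x ∸ r))               ≡⟨ cong suc (greedyAux-ones coins (m ∸ 1) 1-largest (∸-mono (m≤m+n x (q * x)) r>0)) ⟩
    suc (x ∸ r)                                         ∎

-- Arithmetic behind the deficit recursion

deficit-arith-q : ∀ {S q d r G F E T} → 0 < q → 2 * T ≡ q * (q ∸ 1) → S * d ≤ 2 * G + E → S < q ⊎ r ≡ 0 →
  (S + (q ∸ 1)) * (q * d + r) ≤ 2 * (T * d + q * G + (r * q + F)) + q * E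
deficit-arith-q {S} {suc p} {d} {r} {G} {F} {E} {T} _ 2T≡qp Sd≤2G+E S<q⊎r≡0 = begin
  (S + p) * (suc p * d + r)                         ≡⟨ expand S p d r ⟩
  suc p * (S * d) + suc p * p * d + (S + p) * r     ≤⟨ +-mono-≤ (+-mono-≤ (*-monoʳ-≤ (suc p) Sd≤2G+E) (≤-reflexive (cong (_* d) (sym 2T≡qp)))) (Sr≤2rq S<q⊎r≡0) ⟩
  suc p * (2 * G + E) + 2 * T * d + 2 * (r * suc p) ≤⟨ m≤m+n _ (2 * F) ⟩
  suc p * (2 * G + E) + 2 * T * d + 2 * (r * suc p) + 2 * F ≡⟨ collect p G E T d r F ⟩
  2 * (T * d + suc p * G + (r * suc p + F)) + suc p * E ∎
  where
  open ≤-Reasoning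
  expand : ∀ S p d r → (S + p) * (suc p * d + r) ≡ suc p * (S * d) + suc p * p * d + (S + p) * r
  expand = solve-∀
  collect : ∀ p G E T d r F → suc p * (2 * G + E) + 2 * T * d + 2 * (r * suc p) + 2 * F
                            ≡ 2 * (T * d + suc p * G + (r * suc p + F)) + suc p * E
  collect = solve-∀
  double : ∀ p r → (p + p) * r ≡ 2 * (r * p)
  double = solve-∀
  Sr≤2rq : S < suc p ⊎ r ≡ 0 → (S + p) * r ≤ 2 * (r * suc p)
  Sr≤2rq (inj₁ (s≤s S≤p)) = begin
    (S + p) * r      ≤⟨ *-monoˡ-≤ r (+-monoˡ-≤ p S≤p) ⟩
    (p + p) * r      ≡⟨ double p r ⟩
    2 * (r * p)      ≤⟨ *-monoʳ-≤ 2 (*-monoʳ-≤ r (n≤1+n p)) ⟩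
    2 * (r * suc p)  ∎
  Sr≤2rq (inj₂ r≡0) = subst (λ r → (S + p) * r ≤ 2 * (r * suc p)) (sym r≡0) (≤-reflexive (*-zeroʳ (S + p)))

-- Adding the slack w t (this is where q ≤ S enters) turns the left side into the right side up to
-- the two hypotheses.
deficit-arith-a : ∀ {S q w d r t G F E T Qs} → 0 < q → 2 * T ≡ q * (q ∸ 1) → S ≡ q + w → d ≡ r + t →
  S * d ≤ 2 * G + E → G ≤ F + t * Qs →
  (S + q) * (q * d + r) ≤ 2 * (T * d + q * G + (r * q + F)) + (suc q * E + 2 * (t * Qs))
deficit-arith-a {q = q@(suc p)} {w} {r = r} {t} {G} {F} {E} {T} {Qs} _ 2T≡qp refl refl Sd≤2G+E G≤F+tQ = begin
  (q + w + q) * (q * (r + t) + r)                           ≤⟨ m≤m+n _ (w * t) ⟩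
  (q + w + q) * (q * (r + t) + r) + w * t                   ≡⟨ expand p w r t ⟩
  q * p * (r + t) + 2 * (r * q) + suc q * ((q + w) * (r + t)) ≤⟨ +-mono-≤ (+-monoˡ-≤ _ (≤-reflexive (cong (_* (r + t)) (sym 2T≡qp)))) (*-monoʳ-≤ (suc q) Sd≤2G+E) ⟩
  2 * T * (r + t) + 2 * (r * q) + suc q * (2 * G + E)       ≡⟨ split q T (r + t) r G E ⟩
  2 * T * (r + t) + 2 * (r * q) + q * (2 * G) + suc q * E + 2 * G ≤⟨ +-monoʳ-≤ (2 * T * (r + t) + 2 * (r * q) + q * (2 * G) + suc q * E) (*-monoʳ-≤ 2 G≤F+tQ) ⟩
  2 * T * (r + t) + 2 * (r * q) + q * (2 * G) + suc q * E + 2 * (F + t * Qs) ≡⟨ collect q T (r + t) r G E F t Qs ⟩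
  2 * (T * (r + t) + q * G + (r * q + F)) + (suc q * E + 2 * (t * Qs)) ∎
  where
  open ≤-Reasoning
  expand : ∀ p w r t → (suc p + w + suc p) * (suc p * (r + t) + r) + w * t
                     ≡ suc p * p * (r + t) + 2 * (r * suc p) + suc (suc p) * ((suc p + w) * (r + t))
  expand = solve-∀
  split : ∀ q T d r G E → 2 * T * d + 2 * (r * q) + suc q * (2 * G + E)
                        ≡ 2 * T * d + 2 * (r * q) + q * (2 * G) + suc q * E + 2 * G
  split = solve-∀
  collect : ∀ q T d r G E F t Qs → 2 * T * d + 2 * (r * q) + q * (2 * G) + suc q * E + 2 * (F + t * Qs)
                                 ≡ 2 * (T * d + q * G + (r * q + F)) + (suc q * E + 2 * (t * Qs))
  collect = solve-∀

deficit-normalise-q : ∀ {E′ E q d r D Qs} → E′ ≤ q * E → D ≡ q * d + r → E′ * d ≤ D * E + 3 * (D * Qs)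
deficit-normalise-q {E′} {E} {q} {d} {r} {Qs = Qs} E′≤qE refl = begin
  E′ * d                                      ≤⟨ *-monoˡ-≤ d E′≤qE ⟩
  q * E * d                                   ≡⟨ swap q E d ⟩
  q * d * E                                   ≤⟨ *-monoˡ-≤ E (m≤m+n (q * d) r) ⟩
  (q * d + r) * E                             ≤⟨ m≤m+n _ (3 * ((q * d + r) * Qs)) ⟩
  (q * d + r) * E + 3 * ((q * d + r) * Qs)    ∎
  where
  open ≤-Reasoning
  swap : ∀ q E d → q * E * d ≡ q * d * E
  swap = solve-∀

deficit-normalise-a : ∀ {E′ E q d r t S D Qs} → E′ ≤ suc q * E + 2 * (t * Qs) → D ≡ q * d + r → d ≡ r + t →
  t ≤ q → E ≤ S * d → S ≤ Qs → E′ * d ≤ D * E + 3 * (D * Qs)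
deficit-normalise-a {E′} {E} {q} {r = r} {t} {S} {Qs = Qs} E′≤ refl refl t≤q E≤Sd S≤Qs = begin
  E′ * d                                       ≤⟨ *-monoˡ-≤ d E′≤ ⟩
  (suc q * E + 2 * (t * Qs)) * d               ≡⟨ expand q E t Qs r ⟩
  D * E + t * E + 2 * (t * d * Qs)             ≤⟨ +-monoˡ-≤ _ (+-monoʳ-≤ (D * E) tE≤tdQs) ⟩
  D * E + t * d * Qs + 2 * (t * d * Qs)        ≡⟨ collect (D * E) (t * d * Qs) ⟩
  D * E + 3 * (t * d * Qs)                     ≤⟨ +-monoʳ-≤ (D * E) (*-monoʳ-≤ 3 (*-monoˡ-≤ Qs td≤D)) ⟩
  D * E + 3 * (D * Qs)                         ∎
  where
  open ≤-Reasoning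
  d = r + t
  D = q * d + r
  expand : ∀ q E t Qs r → (suc q * E + 2 * (t * Qs)) * (r + t)
                        ≡ (q * (r + t) + r) * E + t * E + 2 * (t * (r + t) * Qs)
  expand = solve-∀
  collect : ∀ x y → x + y + 2 * y ≡ x + 3 * y
  collect = solve-∀
  tE≤tdQs : t * E ≤ t * d * Qs
  tE≤tdQs = begin
    t * E        ≤⟨ *-monoʳ-≤ t E≤Sd ⟩
    t * (S * d)  ≡⟨ reassoc t S d ⟩
    t * d * S    ≤⟨ *-monoʳ-≤ (t * d) S≤Qs ⟩
    t * d * Qs   ∎
    where
    reassoc : ∀ t S d → t * (S * d) ≡ t * d * S
    reassoc = solve-∀
  td≤D : t * d ≤ D
  td≤D = ≤-trans (*-monoˡ-≤ d t≤q) (m≤m+n (q * d) r)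

deficit-invariant-step : ∀ {n e e′ x X Qs K} → 0 < x → e′ * x ≤ X * e + 3 * (X * Qs) →
  2 ^ n * Qs ≤ 4 * suc n * x → 2 ^ n * e + 24 * (2 + n) * x ≤ K * 2 ^ n * x →
  2 ^ suc n * e′ + 24 * (3 + n) * X ≤ K * 2 ^ suc n * X
deficit-invariant-step {n} {e} {e′} {x} {X} {Qs} {K} x>0 step Qs-bound invariant =
  *-cancelˡ-≤ x ⦃ >-nonZero x>0 ⦄ (begin
    x * (2 * P * e′ + 24 * (3 + n) * X)                  ≡⟨ distribute x P e′ n X ⟩
    2 * P * (e′ * x) + 24 * (3 + n) * X * x              ≤⟨ +-monoˡ-≤ (24 * (3 + n) * X * x) (*-monoʳ-≤ (2 * P) step) ⟩
    2 * P * (X * e + 3 * (X * Qs)) + 24 * (3 + n) * X * x ≡⟨ factor-X P X e Qs n x ⟩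
    X * (2 * (P * e) + 6 * (P * Qs) + 24 * (3 + n) * x)  ≤⟨ *-monoʳ-≤ X (+-monoˡ-≤ (24 * (3 + n) * x) (+-monoʳ-≤ (2 * (P * e)) (*-monoʳ-≤ 6 Qs-bound))) ⟩
    X * (2 * (P * e) + 6 * (4 * suc n * x) + 24 * (3 + n) * x) ≡⟨ combine X P e n x ⟩
    X * (2 * (P * e + 24 * (2 + n) * x))                 ≤⟨ *-monoʳ-≤ X (*-monoʳ-≤ 2 invariant) ⟩
    X * (2 * (K * P * x))                                ≡⟨ commute X K P x ⟩
    x * (K * (2 * P) * X)                                ∎)
  where
  open ≤-Reasoning
  P = 2 ^ n
  distribute : ∀ x P e′ n X → x * (2 * P * e′ + 24 * (3 + n) * X) ≡ 2 * P * (e′ * x) + 24 * (3 + n) * X * x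
  distribute = solve-∀
  factor-X : ∀ P X e Qs n x → 2 * P * (X * e + 3 * (X * Qs)) + 24 * (3 + n) * X * x
                      ≡ X * (2 * (P * e) + 6 * (P * Qs) + 24 * (3 + n) * x)
  factor-X = solve-∀
  combine : ∀ X P e n x → X * (2 * (P * e) + 6 * (4 * suc n * x) + 24 * (3 + n) * x) ≡ X * (2 * (P * e + 24 * (2 + n) * x))
  combine = solve-∀
  commute : ∀ X K P x → X * (2 * (K * P * x)) ≡ x * (K * (2 * P) * X)
  commute = solve-∀

qSum-bound-step : ∀ {n P x X Qs k} → P * Qs ≤ 4 * suc n * x → P ≤ x → 2 * x ≤ suc X → k * x ≤ X →
  2 * suc n ≤ X → 2 * P * (Qs + k) ≤ 4 * (2 + n) * X
qSum-bound-step {n} {P} {x} {X} {Qs} {k} PQs≤ P≤x 2x≤1+X kx≤X 2[1+n]≤X = begin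
  2 * P * (Qs + k)                        ≡⟨ distribute P Qs k ⟩
  2 * (P * Qs) + 2 * (P * k)              ≤⟨ +-mono-≤ (*-monoʳ-≤ 2 PQs≤) (*-monoʳ-≤ 2 (*-monoˡ-≤ k P≤x)) ⟩
  2 * (4 * suc n * x) + 2 * (x * k)       ≡⟨ double-x n x k ⟩
  4 * suc n * (2 * x) + 2 * (k * x)       ≤⟨ +-mono-≤ (*-monoʳ-≤ (4 * suc n) 2x≤1+X) (*-monoʳ-≤ 2 kx≤X) ⟩
  4 * suc n * suc X + 2 * X               ≡⟨ expand-suc n X ⟩
  4 * suc n * X + 2 * (2 * suc n) + 2 * X ≤⟨ +-monoˡ-≤ (2 * X) (+-monoʳ-≤ (4 * suc n * X) (*-monoʳ-≤ 2 2[1+n]≤X)) ⟩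
  4 * suc n * X + 2 * X + 2 * X           ≡⟨ collect n X ⟩
  4 * (2 + n) * X                         ∎
  where
  open ≤-Reasoning
  distribute : ∀ P Qs k → 2 * P * (Qs + k) ≡ 2 * (P * Qs) + 2 * (P * k)
  distribute = solve-∀
  double-x : ∀ n x k → 2 * (4 * suc n * x) + 2 * (x * k) ≡ 4 * suc n * (2 * x) + 2 * (k * x)
  double-x = solve-∀
  expand-suc : ∀ n X → 4 * suc n * suc X + 2 * X ≡ 4 * suc n * X + 2 * (2 * suc n) + 2 * X
  expand-suc = solve-∀
  collect : ∀ n X → 4 * suc n * X + 2 * X + 2 * X ≡ 4 * (2 + n) * X
  collect = solve-∀

b-cases : ∀ c i → (q c (2 + i) ≤ s c (1 + i) × b c (2 + i) ≡ a c (2 + i))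
                ⊎ (s c (1 + i) < q c (2 + i) × b c (2 + i) ≡ q c (2 + i))
b-cases c i with q c (2 + i) ≤ᵇ s c (1 + i) in q≤ᵇs
... | true  = inj₁ (≤ᵇ⇒≤ _ _ (subst T (sym q≤ᵇs) _) , refl)
... | false = inj₂ (≰⇒> (λ q≤s → subst T q≤ᵇs (≤⇒≤ᵇ q≤s)) , refl)

module CoinSequence {c : ℕ → ℕ} (c0≡1 : c 0 ≡ 1) (c-inc : ∀ i → c i < c (suc i)) where

  c-pos : ∀ i → 0 < c i
  c-pos zero    = subst (0 <_) (sym c0≡1) (s≤s z≤n)
  c-pos (suc i) = ≤-<-trans z≤n (c-inc i)

  i<c : ∀ i → i < c i
  i<c zero    = c-pos zero
  i<c (suc i) = ≤-<-trans (i<c i) (c-inc i)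

  c-mono : ∀ {i j} → i ≤ j → c i ≤ c j
  c-mono {j = zero}  z≤n = ≤-refl
  c-mono {i} {suc j} i≤1+j with m≤n⇒m<n∨m≡n i≤1+j
  ... | inj₁ (s≤s i≤j) = ≤-trans (c-mono i≤j) (<⇒≤ (c-inc j))
  ... | inj₂ refl      = ≤-refl

  q1≡c1 : q c 1 ≡ c 1
  q1≡c1 rewrite c0≡1 = n/1≡n (c 1)

  s1≡c1∸1 : s c 1 ≡ c 1 ∸ 1
  s1≡c1∸1 = cong (_∸ 1) q1≡c1

  rem : ℕ → ℕ
  rem i = modN (c (2 + i)) (c (1 + i))

  c-divMod : ∀ i → c (2 + i) ≡ q c (2 + i) * c (1 + i) + rem i
  c-divMod i = divN-modN (c (2 + i)) (c-pos (1 + i))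

  rem<c : ∀ i → rem i < c (1 + i)
  rem<c i = modN< (c (2 + i)) (c-pos (1 + i))

  q*c≤c : ∀ i → q c (2 + i) * c (1 + i) ≤ c (2 + i)
  q*c≤c i = subst (q c (2 + i) * c (1 + i) ≤_) (sym (c-divMod i)) (m≤m+n _ (rem i))

  c<[1+q]*c : ∀ i → c (2 + i) < suc (q c (2 + i)) * c (1 + i)
  c<[1+q]*c i = subst (_< suc (q c (2 + i)) * c (1 + i)) (sym (c-divMod i))
    (subst (q c (2 + i) * c (1 + i) + rem i <_) (+-comm (q c (2 + i) * c (1 + i)) (c (1 + i)))
      (+-monoʳ-< (q c (2 + i) * c (1 + i)) (rem<c i)))

  q-pos : ∀ i → 0 < q c (2 + i)
  q-pos i = n≢0⇒n>0 λ q≡0 → <⇒≱ (c-inc (1 + i))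
    (subst (_≤ c (1 + i)) (sym (trans (c-divMod i) (cong (λ x → x * c (1 + i) + rem i) q≡0))) (<⇒≤ (rem<c i)))

  c-exact : ∀ i → rem i ≡ 0 → c (2 + i) ≡ q c (2 + i) * c (1 + i)
  c-exact i rem≡0 = trans (c-divMod i) (trans (cong (_+_ (q c (2 + i) * c (1 + i))) rem≡0) (+-identityʳ _))

  a-exact : ∀ i → rem i ≡ 0 → a c (2 + i) ≡ q c (2 + i)
  a-exact i rem≡0 = trans (cong (λ m → ceilDivN m (c (1 + i))) (c-exact i rem≡0)) (ceilDivN-exact _ (c-pos (1 + i)))

  a-inexact : ∀ i → 0 < rem i → a c (2 + i) ≡ suc (q c (2 + i))
  a-inexact i rem>0 = trans (cong (λ m → ceilDivN m (c (1 + i))) (c-divMod i)) (ceilDivN-inexact _ rem>0 (rem<c i))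

  a≤1+q : ∀ i → a c (2 + i) ≤ suc (q c (2 + i))
  a≤1+q i with rem i ≟ 0
  ... | yes rem≡0 = ≤-trans (≤-reflexive (a-exact i rem≡0)) (n≤1+n _)
  ... | no  rem≢0 = ≤-reflexive (a-inexact i (n≢0⇒n>0 rem≢0))

  c≤a*c : ∀ i → c (2 + i) ≤ a c (2 + i) * c (1 + i)
  c≤a*c i with rem i ≟ 0
  ... | yes rem≡0 = ≤-reflexive (trans (c-exact i rem≡0) (cong (_* c (1 + i)) (sym (a-exact i rem≡0))))
  ... | no  rem≢0 = subst (c (2 + i) ≤_) (cong (_* c (1 + i)) (sym (a-inexact i (n≢0⇒n>0 rem≢0)))) (<⇒≤ (c<[1+q]*c i))

  2≤a : ∀ i → 2 ≤ a c (2 + i)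
  2≤a i = *-cancelʳ-< (c (1 + i)) 1 (a c (2 + i))
    (subst (_< a c (2 + i) * c (1 + i)) (sym (*-identityˡ (c (1 + i)))) (<-≤-trans (c-inc (1 + i)) (c≤a*c i)))

  b-≥2 : ∀ i → 1 ≤ s c (1 + i) → 2 ≤ b c (2 + i)
  b-≥2 i s≥1 with b-cases c i
  ... | inj₁ (_   , b≡a) = subst (2 ≤_) (sym b≡a) (2≤a i)
  ... | inj₂ (s<q , b≡q) = subst (2 ≤_) (sym b≡q) (≤-<-trans s≥1 s<q)

  n≤s : ∀ i → suc i ≤ s c (suc i)
  n≤s zero    = subst (1 ≤_) (sym s1≡c1∸1) (m<n⇒0<n∸m (i<c 1))
  n≤s (suc i) = subst (_≤ s c (2 + i)) (+-comm (suc i) 1)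
    (+-mono-≤ (n≤s i) (∸-monoˡ-≤ 1 (b-≥2 i (≤-trans (s≤s z≤n) (n≤s i)))))

  c≤2^[1+s]-b≡q : ∀ i → s c (1 + i) < q c (2 + i) → c (1 + i) ≤ 2 ^ suc (s c (1 + i)) →
                  c (2 + i) ≤ 2 ^ suc (s c (1 + i) + (q c (2 + i) ∸ 1))
  c≤2^[1+s]-b≡q i s<q c≤2^[1+s] with 3 ≤? q c (2 + i)
  ... | yes 3≤q = <⇒≤ (begin-strict
    c (2 + i)                                      <⟨ c<[1+q]*c i ⟩
    suc (q c (2 + i)) * c (1 + i)                  ≤⟨ *-mono-≤ (1+n≤2^[n∸1] 3≤q) c≤2^[1+s] ⟩
    2 ^ (q c (2 + i) ∸ 1) * 2 ^ suc (s c (1 + i))  ≡⟨ 2^-shift (q c (2 + i) ∸ 1) (s c (1 + i)) ⟩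
    2 ^ suc (s c (1 + i) + (q c (2 + i) ∸ 1))      ∎)
    where open ≤-Reasoning
  c≤2^[1+s]-b≡q zero    s<q _ | no q≱3 = <⇒≤ (begin-strict
    c 2                            <⟨ c<[1+q]*c 0 ⟩
    suc (q c 2) * c 1              ≤⟨ *-mono-≤ (≰⇒> q≱3) c1≤2 ⟩
    3 * 2                          <⟨ ≤ᵇ⇒≤ 7 8 _ ⟩
    2 ^ 3                          ≤⟨ ^-monoʳ-≤ 2 (s≤s (+-mono-≤ (n≤s 0) (∸-monoˡ-≤ 1 (≤-<-trans (n≤s 0) s<q)))) ⟩
    2 ^ suc (s c 1 + (q c 2 ∸ 1))  ∎)
    where
    open ≤-Reasoning
    c1≤2 : c 1 ≤ 2
    c1≤2 = subst (_≤ 2) (m∸n+n≡m (c-pos 1))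
      (+-monoˡ-≤ 1 (subst (_≤ 1) s1≡c1∸1 (s≤s⁻¹ (<-≤-trans s<q (s≤s⁻¹ (≰⇒> q≱3))))))
  c≤2^[1+s]-b≡q (suc i) s<q _ | no q≱3 = ⊥-elim (<⇒≱ (<-≤-trans s<q (s≤s⁻¹ (≰⇒> q≱3))) (≤-trans (s≤s (s≤s z≤n)) (n≤s (suc i))))

  c≤2^[1+s] : ∀ i → c (suc i) ≤ 2 ^ suc (s c (suc i))
  c≤2^[1+s] zero = subst (λ n → c 1 ≤ 2 ^ suc n) (sym s1≡c1∸1)
    (≤-trans (n≤2^[n∸1] (c 1)) (^-monoʳ-≤ 2 (n≤1+n (c 1 ∸ 1))))
  c≤2^[1+s] (suc i) with b-cases c i
  ... | inj₁ (_ , b≡a) rewrite b≡a = begin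
    c (2 + i)                                      ≤⟨ c≤a*c i ⟩
    a c (2 + i) * c (1 + i)                        ≤⟨ *-mono-≤ (n≤2^[n∸1] (a c (2 + i))) (c≤2^[1+s] i) ⟩
    2 ^ (a c (2 + i) ∸ 1) * 2 ^ suc (s c (1 + i))  ≡⟨ 2^-shift (a c (2 + i) ∸ 1) (s c (1 + i)) ⟩
    2 ^ suc (s c (1 + i) + (a c (2 + i) ∸ 1))      ∎
    where open ≤-Reasoning
  ... | inj₂ (s<q , b≡q) rewrite b≡q = c≤2^[1+s]-b≡q i s<q (c≤2^[1+s] i)

  qSum : ℕ → ℕ
  qSum i = ∑[ j < suc i ] q c (suc j)

  s≤qSum : ∀ i → s c (suc i) ≤ qSum i
  s≤qSum zero    = m∸n≤m (q c 1) 1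
  s≤qSum (suc i) = +-mono-≤ (s≤qSum i) b∸1≤q
    where
    b∸1≤q : b c (2 + i) ∸ 1 ≤ q c (2 + i)
    b∸1≤q with b-cases c i
    ... | inj₁ (_ , b≡a) rewrite b≡a = ∸-monoˡ-≤ 1 (a≤1+q i)
    ... | inj₂ (_ , b≡q) rewrite b≡q = m∸n≤m (q c (2 + i)) 1

  greedy : ℕ → ℕ → ℕ
  greedy zero    m = m
  greedy (suc i) m = divN m (c (suc i)) + greedy i (modN m (c (suc i)))

  greedy-block : ∀ {i} j {u} → u < c (suc i) → greedy (suc i) (j * c (suc i) + u) ≡ j + greedy i u
  greedy-block {i} j u<c = cong₂ _+_ (divN-unique j u<c) (cong (greedy i) (modN-unique j u<c))

  greedy-below : ∀ {i m} → m < c (suc i) → greedy (suc i) m ≡ greedy i m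
  greedy-below = greedy-block 0

  greedy-above : ∀ {i m} → c (suc i) ≤ m → greedy (suc i) m ≡ suc (greedy (suc i) (m ∸ c (suc i)))
  greedy-above {i} c≤m = cong₂ _+_ (divN-∸ (c-pos (suc i)) c≤m) (cong (greedy i) (sym (modN-∸ c≤m)))

  greedy-zero : ∀ i → greedy i 0 ≡ 0
  greedy-zero zero    = refl
  greedy-zero (suc i) = trans (greedy-below (c-pos (suc i))) (greedy-zero i)

  greedy-stable : ∀ {i j m} → m < c (suc j) → j ≤ i → greedy i m ≡ greedy j m
  greedy-stable {zero}  m<c z≤n = refl
  greedy-stable {suc i} {j} {m} m<c j≤1+i with m≤n⇒m<n∨m≡n j≤1+i
  ... | inj₁ (s≤s j≤i) = trans (greedy-below (<-≤-trans m<c (c-mono (s≤s j≤i)))) (greedy-stable m<c j≤i)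
  ... | inj₂ refl      = refl

  greedy-≤-qSum : ∀ i {u} → u < c (suc i) → greedy i u ≤ qSum i
  greedy-≤-qSum zero    {u} u<c = subst (u ≤_) (sym q1≡c1) (<⇒≤ u<c)
  greedy-≤-qSum (suc i) {u} u<c = subst (_≤ qSum (suc i)) (+-comm (greedy i _) (divN u (c (suc i))))
    (+-mono-≤ (greedy-≤-qSum i (modN< u (c-pos (suc i)))) (divN-monoˡ-≤ (c (suc i)) (<⇒≤ u<c)))

  top : ℕ → ℕ → ℕ
  top zero    m = 0
  top (suc i) m with c (suc i) ≤? m
  ... | yes _ = suc i
  ... | no  _ = top i m

  top≤ : ∀ i m → top i m ≤ i
  top≤ zero    m = z≤n
  top≤ (suc i) m with c (suc i) ≤? m
  ... | yes _ = ≤-refl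
  ... | no  _ = m≤n⇒m≤1+n (top≤ i m)

  c-top≤ : ∀ i {m} → 1 ≤ m → c (top i m) ≤ m
  c-top≤ zero    1≤m = subst (_≤ _) (sym c0≡1) 1≤m
  c-top≤ (suc i) {m} 1≤m with c (suc i) ≤? m
  ... | yes c≤m = c≤m
  ... | no  _   = c-top≤ i 1≤m

  top-maximal : ∀ i {m j} → j ≤ i → c j ≤ m → j ≤ top i m
  top-maximal zero    j≤i _ = j≤i
  top-maximal (suc i) {m} j≤1+i cj≤m with c (suc i) ≤? m
  ... | yes _ = j≤1+i
  ... | no  c≰m with m≤n⇒m<n∨m≡n j≤1+i
  ...   | inj₁ (s≤s j≤i) = top-maximal i j≤i cj≤m
  ...   | inj₂ refl      = ⊥-elim (c≰m cj≤m)

  greedy-top : ∀ i {m} → 1 ≤ m → greedy i m ≡ suc (greedy i (m ∸ c (top i m)))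
  greedy-top zero    {suc m} _ rewrite c0≡1 = refl
  greedy-top (suc i) {m} 1≤m with c (suc i) ≤? m
  ... | yes c≤m = greedy-above c≤m
  ... | no  c≰m = begin
    greedy (suc i) m                             ≡⟨ greedy-below m<c ⟩
    greedy i m                                   ≡⟨ greedy-top i 1≤m ⟩
    suc (greedy i (m ∸ c (top i m)))             ≡⟨ cong suc (greedy-below (≤-<-trans (m∸n≤m m (c (top i m))) m<c)) ⟨
    suc (greedy (suc i) (m ∸ c (top i m)))       ∎
    where
    open ≡-Reasoning
    m<c : m < c (suc i)
    m<c = ≰⇒> c≰m

  largestLE-firstN : ∀ i {m} → 1 ≤ m → largestLE (firstN c (suc i)) m ≡ c (top i m)
  largestLE-firstN i {m} 1≤m = largestLE-≡ (firstN c (suc i)) m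
    (∈-map⁺ c (∈-upTo⁺ (s≤s (top≤ i m)))) (c-top≤ i 1≤m) maximal
    where
    maximal : ∀ {y} → y ∈ firstN c (suc i) → y ≤ m → y ≤ c (top i m)
    maximal y∈ y≤m with ∈-map⁻ c y∈
    ... | j , j∈ , refl = c-mono (top-maximal i (s≤s⁻¹ (∈-upTo⁻ j∈)) y≤m)

  greedyAux-firstN : ∀ f i {m} → m ≤ f → greedyAux f (firstN c (suc i)) m ≡ greedy i m
  greedyAux-firstN zero    i {zero}  _   = sym (greedy-zero i)
  greedyAux-firstN (suc f) i {zero}  _   = sym (greedy-zero i)
  greedyAux-firstN (suc f) i {suc m} m≤f = begin
    greedyAux (suc f) (firstN c (suc i)) (suc m)                    ≡⟨ cong (λ v → suc (greedyAux f _ (suc m ∸ v))) (largestLE-firstN i (s≤s z≤n)) ⟩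
    suc (greedyAux f (firstN c (suc i)) (suc m ∸ c (top i (suc m)))) ≡⟨ cong suc (greedyAux-firstN f i fuel) ⟩
    suc (greedy i (suc m ∸ c (top i (suc m))))                       ≡⟨ greedy-top i (s≤s z≤n) ⟨
    greedy i (suc m)                                                 ∎
    where
    open ≡-Reasoning
    fuel : suc m ∸ c (top i (suc m)) ≤ f
    fuel = ≤-trans (∸-monoʳ-≤ (suc m) (c-pos (top i (suc m)))) (s≤s⁻¹ m≤f)

  G : ℕ → ℕ
  G i = ∑[ m < c (suc i) ] greedy i m

  ∑-greedy-blocks : ∀ i j → ∑[ m < j * c (suc i) ] greedy (suc i) m ≡ (∑[ k < j ] k) * c (suc i) + j * G i
  ∑-greedy-blocks i zero    = refl
  ∑-greedy-blocks i (suc j) = begin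
    ∑[ m < c (suc i) + j * c (suc i) ] greedy (suc i) m        ≡⟨ cong (λ n → ∑ n (greedy (suc i))) (+-comm (c (suc i)) (j * c (suc i))) ⟩
    ∑[ m < j * c (suc i) + c (suc i) ] greedy (suc i) m        ≡⟨ ∑-+ (j * c (suc i)) (c (suc i)) (greedy (suc i)) ⟩
    ∑[ m < j * c (suc i) ] greedy (suc i) m
      + ∑[ u < c (suc i) ] greedy (suc i) (j * c (suc i) + u)  ≡⟨ cong₂ _+_ (∑-greedy-blocks i j) (∑-cong (c (suc i)) (greedy-block j)) ⟩
    (∑[ k < j ] k) * c (suc i) + j * G i
      + ∑[ u < c (suc i) ] (j + greedy i u)                    ≡⟨ cong (_+_ ((∑[ k < j ] k) * c (suc i) + j * G i)) (∑-const-+ (c (suc i)) j (greedy i)) ⟩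
    (∑[ k < j ] k) * c (suc i) + j * G i + (c (suc i) * j + G i) ≡⟨ regroup (∑[ k < j ] k) j (c (suc i)) (G i) ⟩
    (∑[ k < j ] k + j) * c (suc i) + (G i + j * G i)           ∎
    where
    open ≡-Reasoning
    regroup : ∀ T j x g → T * x + j * g + (x * j + g) ≡ (T + j) * x + (g + j * g)
    regroup = solve-∀

  G-suc : ∀ i → G (suc i) ≡ (∑[ k < q c (2 + i) ] k) * c (1 + i) + q c (2 + i) * G i
                           + (rem i * q c (2 + i) + ∑[ u < rem i ] greedy i u)
  G-suc i = begin
    ∑[ m < c (2 + i) ] greedy (suc i) m                               ≡⟨ cong (λ n → ∑ n (greedy (suc i))) (c-divMod i) ⟩
    ∑[ m < qᵢ * c (1 + i) + rem i ] greedy (suc i) m                  ≡⟨ ∑-+ (qᵢ * c (1 + i)) (rem i) (greedy (suc i)) ⟩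
    ∑[ m < qᵢ * c (1 + i) ] greedy (suc i) m
      + ∑[ u < rem i ] greedy (suc i) (qᵢ * c (1 + i) + u)            ≡⟨ cong₂ _+_ (∑-greedy-blocks i qᵢ) (∑-cong (rem i) (λ u<r → greedy-block qᵢ (<-trans u<r (rem<c i)))) ⟩
    (∑[ k < qᵢ ] k) * c (1 + i) + qᵢ * G i + ∑[ u < rem i ] (qᵢ + greedy i u) ≡⟨ cong (_+_ ((∑[ k < qᵢ ] k) * c (1 + i) + qᵢ * G i)) (∑-const-+ (rem i) qᵢ (greedy i)) ⟩
    (∑[ k < qᵢ ] k) * c (1 + i) + qᵢ * G i + (rem i * qᵢ + ∑[ u < rem i ] greedy i u) ∎
    where
    open ≡-Reasoning
    qᵢ = q c (2 + i)

  G-≤-head : ∀ i {r} → r ≤ c (suc i) → G i ≤ ∑[ u < r ] greedy i u + (c (suc i) ∸ r) * qSum i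
  G-≤-head i {r} r≤c = begin
    ∑[ m < c (suc i) ] greedy i m                                    ≡⟨ cong (λ n → ∑ n (greedy i)) (sym (m+[n∸m]≡n r≤c)) ⟩
    ∑[ m < r + (c (suc i) ∸ r) ] greedy i m                          ≡⟨ ∑-+ r (c (suc i) ∸ r) (greedy i) ⟩
    ∑[ u < r ] greedy i u + ∑[ u < c (suc i) ∸ r ] greedy i (r + u)  ≤⟨ +-monoʳ-≤ _ (∑-mono-≤ (c (suc i) ∸ r) (λ u<c∸r → greedy-≤-qSum i (below u<c∸r))) ⟩
    ∑[ u < r ] greedy i u + ∑[ _ < c (suc i) ∸ r ] qSum i            ≡⟨ cong (_+_ (∑[ u < r ] greedy i u)) (∑-const (c (suc i) ∸ r) (qSum i)) ⟩
    ∑[ u < r ] greedy i u + (c (suc i) ∸ r) * qSum i                 ∎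
    where
    open ≤-Reasoning
    below : ∀ {u} → u < c (suc i) ∸ r → r + u < c (suc i)
    below u<c∸r = subst (_ <_) (m+[n∸m]≡n r≤c) (+-monoʳ-< r u<c∸r)

  -- The E_n of the header, with n = i + 1.
  deficit : ℕ → ℕ
  deficit i = s c (suc i) * c (suc i) ∸ 2 * G i

  deficit-≤-of : ∀ i {X} → s c (suc i) * c (suc i) ≤ 2 * G i + X → deficit i ≤ X
  deficit-≤-of i = m≤n+o⇒m∸n≤o _ (2 * G i)

  s*c≤2G+deficit : ∀ i → s c (suc i) * c (suc i) ≤ 2 * G i + deficit i
  s*c≤2G+deficit i = m≤n+m∸n _ (2 * G i)

  deficit-when-b≡q : ∀ i → b c (2 + i) ≡ q c (2 + i) → s c (1 + i) < q c (2 + i) ⊎ rem i ≡ 0 →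
                     deficit (suc i) ≤ q c (2 + i) * deficit i
  deficit-when-b≡q i b≡q s<q⊎rem≡0 = deficit-≤-of (suc i) (begin
    s c (2 + i) * c (2 + i)                                           ≡⟨ cong₂ _*_ (cong (λ x → s c (1 + i) + (x ∸ 1)) b≡q) (c-divMod i) ⟩
    (s c (1 + i) + (qᵢ ∸ 1)) * (qᵢ * c (1 + i) + rem i)               ≤⟨ deficit-arith-q {T = ∑[ k < qᵢ ] k} (q-pos i) (double-∑-id qᵢ) (s*c≤2G+deficit i) s<q⊎rem≡0 ⟩
    2 * ((∑[ k < qᵢ ] k) * c (1 + i) + qᵢ * G i + (rem i * qᵢ + F)) + qᵢ * deficit i ≡⟨ cong (λ g → 2 * g + qᵢ * deficit i) (G-suc i) ⟨
    2 * G (suc i) + qᵢ * deficit i                                    ∎)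
    where
    open ≤-Reasoning
    qᵢ = q c (2 + i)
    F = ∑[ u < rem i ] greedy i u

  deficit-when-b≡1+q : ∀ i → b c (2 + i) ≡ suc (q c (2 + i)) → q c (2 + i) ≤ s c (1 + i) →
                       deficit (suc i) ≤ suc (q c (2 + i)) * deficit i + 2 * ((c (1 + i) ∸ rem i) * qSum i)
  deficit-when-b≡1+q i b≡1+q q≤s = deficit-≤-of (suc i) (begin
    s c (2 + i) * c (2 + i)                                           ≡⟨ cong₂ _*_ (cong (λ x → s c (1 + i) + (x ∸ 1)) b≡1+q) (c-divMod i) ⟩
    (s c (1 + i) + qᵢ) * (qᵢ * c (1 + i) + rem i)                     ≤⟨ deficit-arith-a {T = ∑[ k < qᵢ ] k} (q-pos i) (double-∑-id qᵢ) (sym (m+[n∸m]≡n q≤s))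
                                                                           (sym (m+[n∸m]≡n (<⇒≤ (rem<c i)))) (s*c≤2G+deficit i) (G-≤-head i (<⇒≤ (rem<c i))) ⟩
    2 * ((∑[ k < qᵢ ] k) * c (1 + i) + qᵢ * G i + (rem i * qᵢ + F)) + X ≡⟨ cong (λ g → 2 * g + X) (G-suc i) ⟨
    2 * G (suc i) + X                                                 ∎)
    where
    open ≤-Reasoning
    qᵢ = q c (2 + i)
    F = ∑[ u < rem i ] greedy i u
    X = suc qᵢ * deficit i + 2 * ((c (1 + i) ∸ rem i) * qSum i)

  module Greedy (complete : InfCompletelyGreedy c) where

    optInf≡greedy : ∀ i {m} → 1 ≤ m → m < c (suc i) → optInf c m ≡ greedy i m
    optInf≡greedy i {m} 1≤m m<c = begin
      optInf c m                             ≡⟨ complete (suc m) (firstN c (suc m)) ⊆-refl (here (sym c0≡1)) m 1≤m ⟨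
      greedyAux m (firstN c (suc m)) m       ≡⟨ greedyAux-firstN m m ≤-refl ⟩
      greedy m m                             ≡⟨ greedy-m≡greedy-i ⟩
      greedy i m                             ∎
      where
      open ≡-Reasoning
      greedy-m≡greedy-i : greedy m m ≡ greedy i m
      greedy-m≡greedy-i with ≤-total m i
      ... | inj₁ m≤i = sym (greedy-stable (<-trans (n<1+n m) (i<c (suc m))) m≤i)
      ... | inj₂ i≤m = greedy-stable m<c i≤m

    cost≡∑greedy : ∀ i {N} → N < c (suc i) → cost c N ≡ ∑[ m < suc N ] greedy i m
    cost≡∑greedy i {zero}  _   = sym (greedy-zero i)
    cost≡∑greedy i {suc N} N<c =
      cong₂ _+_ (cost≡∑greedy i (<-trans (n<1+n N) N<c)) (optInf≡greedy i (s≤s z≤n) N<c)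

    cost≡G : ∀ i → cost c (c (suc i) ∸ 1) ≡ G i
    cost≡G i = trans (cost≡∑greedy i (subst (c (suc i) ∸ 1 <_) 1+[c∸1]≡c (n<1+n _))) (cong (λ n → ∑ n (greedy i)) 1+[c∸1]≡c)
      where
      1+[c∸1]≡c : suc (c (suc i) ∸ 1) ≡ c (suc i)
      1+[c∸1]≡c = trans (+-comm 1 _) (m∸n+n≡m (c-pos (suc i)))

    c∸rem≤q : ∀ i → 0 < rem i → c (1 + i) ∸ rem i ≤ q c (2 + i)
    c∸rem≤q i rem>0 = three-coin-greedy (≤-<-trans (s≤s z≤n) (i<c (1 + i))) (c-inc (1 + i)) (c-divMod i) rem>0 (rem<c i)
      (complete (3 + i) (1 ∷ c (1 + i) ∷ c (2 + i) ∷ []) coins⊆ (here refl))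
      where
      coins⊆ : 1 ∷ c (1 + i) ∷ c (2 + i) ∷ [] ⊆ firstN c (3 + i)
      coins⊆ = subst (1 ∷ c (1 + i) ∷ c (2 + i) ∷ [] ⊆_) (sym (map-upTo c (3 + i)))
        (sym c0≡1 ∷ˢ adjacent⊆applyUpTo (λ j → c (suc j)) i)

    c-grows : ∀ j → 2 * c j ≤ suc (c (suc j))
    c-grows zero rewrite c0≡1 = s≤s (c-pos 1)
    c-grows (suc i) with 2 ≤? q c (2 + i)
    ... | yes 2≤q = m≤n⇒m≤1+n (≤-trans (*-monoˡ-≤ (c (1 + i)) 2≤q) (q*c≤c i))
    ... | no  2≰q = begin
      2 * c (1 + i)                 ≡⟨ cong (_+_ (c (1 + i))) (+-identityʳ _) ⟩
      c (1 + i) + c (1 + i)         ≤⟨ +-monoʳ-≤ (c (1 + i)) c≤1+rem ⟩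
      c (1 + i) + suc (rem i)       ≡⟨ +-suc (c (1 + i)) (rem i) ⟩
      suc (c (1 + i) + rem i)       ≡⟨ cong (λ x → suc (x + rem i)) (+-identityʳ (c (1 + i))) ⟨
      suc (1 * c (1 + i) + rem i)   ≡⟨ cong suc (trans (c-divMod i) (cong (λ x → x * c (1 + i) + rem i) q≡1)) ⟨
      suc (c (2 + i))               ∎
      where
      open ≤-Reasoning
      q≡1 : q c (2 + i) ≡ 1
      q≡1 = ≤-antisym (s≤s⁻¹ (≰⇒> 2≰q)) (q-pos i)
      rem>0 : 0 < rem i
      rem>0 = n≢0⇒n>0 λ rem≡0 → <⇒≢ (c-inc (1 + i))
        (sym (trans (c-exact i rem≡0) (trans (cong (_* c (1 + i)) q≡1) (*-identityˡ (c (1 + i))))))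
      c≤1+rem : c (1 + i) ≤ suc (rem i)
      c≤1+rem = subst (c (1 + i) ≤_) (+-comm (rem i) 1) (≤-trans (m≤n+m∸n (c (1 + i)) (rem i))
        (+-monoʳ-≤ (rem i) (subst (c (1 + i) ∸ rem i ≤_) q≡1 (c∸rem≤q i rem>0))))

    2^i<c : ∀ i → 2 ^ i < c (suc i)
    2^i<c zero    = i<c 1
    2^i<c (suc i) = s≤s⁻¹ (≤-trans (≤-reflexive (sym (*-suc 2 (2 ^ i)))) (≤-trans (*-monoʳ-≤ 2 (2^i<c i)) (c-grows (suc i))))

    qSum-bound : ∀ i → 2 ^ i * qSum i ≤ 4 * suc i * c (suc i)
    qSum-bound zero    = ≤-trans (≤-reflexive (trans (*-identityˡ (q c 1)) q1≡c1)) (m≤n*m (c 1) 4)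
    qSum-bound (suc i) = qSum-bound-step (qSum-bound i) (<⇒≤ (2^i<c i)) (c-grows (suc i)) (q*c≤c i)
      (≤-trans (2*n≤2^n (suc i)) (<⇒≤ (2^i<c (suc i))))

    deficit-step : ∀ i → deficit (suc i) * c (1 + i) ≤ c (2 + i) * deficit i + 3 * (c (2 + i) * qSum i)
    deficit-step i with b-cases c i | rem i ≟ 0
    ... | inj₁ (_   , b≡a) | yes rem≡0 =
      deficit-normalise-q {q = q c (2 + i)} (deficit-when-b≡q i (trans b≡a (a-exact i rem≡0)) (inj₂ rem≡0)) (c-divMod i)
    ... | inj₁ (q≤s , b≡a) | no rem≢0 =
      deficit-normalise-a (deficit-when-b≡1+q i (trans b≡a (a-inexact i rem>0)) q≤s) (c-divMod i)
        (sym (m+[n∸m]≡n (<⇒≤ (rem<c i)))) (c∸rem≤q i rem>0) (m∸n≤m _ (2 * G i)) (s≤qSum i)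
      where
      rem>0 = n≢0⇒n>0 rem≢0
    ... | inj₂ (s<q , b≡q) | _ =
      deficit-normalise-q {q = q c (2 + i)} (deficit-when-b≡q i b≡q (inj₁ s<q)) (c-divMod i)

    -- 24 (2 + i) / 2^i drops by exactly 12 (1 + i) / 2^i from i to 1 + i, which pays for the growth
    -- 3 qSum i / c (suc i) ≤ 12 (1 + i) / 2^i of deficit i / c (suc i) (deficit-step, qSum-bound).
    K : ℕ
    K = s c 1 + 48

    deficit-invariant : ∀ i → 2 ^ i * deficit i + 24 * (2 + i) * c (suc i) ≤ K * 2 ^ i * c (suc i)
    deficit-invariant zero = begin
      1 * deficit 0 + 48 * c 1        ≤⟨ +-monoˡ-≤ (48 * c 1) (≤-trans (≤-reflexive (*-identityˡ _)) (m∸n≤m _ (2 * G 0))) ⟩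
      s c 1 * c 1 + 48 * c 1          ≡⟨ factor (s c 1) (c 1) ⟩
      (s c 1 + 48) * 1 * c 1          ∎
      where
      open ≤-Reasoning
      factor : ∀ S x → S * x + 48 * x ≡ (S + 48) * 1 * x
      factor = solve-∀
    deficit-invariant (suc i) =
      deficit-invariant-step {n = i} {deficit i} {deficit (suc i)} {K = K} (c-pos (suc i)) (deficit-step i) (qSum-bound i) (deficit-invariant i)

    deficit-≤-K*c : ∀ i → deficit i ≤ K * c (suc i)
    deficit-≤-K*c i = *-cancelˡ-≤ (2 ^ i) ⦃ >-nonZero (m^n>0 2 i) ⦄ (begin
      2 ^ i * deficit i                                 ≤⟨ m≤m+n _ _ ⟩
      2 ^ i * deficit i + 24 * (2 + i) * c (suc i)      ≤⟨ deficit-invariant i ⟩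
      K * 2 ^ i * c (suc i)                             ≡⟨ swap K (2 ^ i) (c (suc i)) ⟩
      2 ^ i * (K * c (suc i))                           ∎)
      where
      open ≤-Reasoning
      swap : ∀ k p x → k * p * x ≡ p * (k * x)
      swap = solve-∀

-- Conversion to ℚᵘ

-½_ : ℕ → Q.ℚᵘ
-½ n = (ℤ.- (+ n)) Q./ 2

S/2*x-½E≤G : ∀ S x G E → S * x ≤ 2 * G + E →
  ((+ S) Q./ 2) Q.* ((+ x) Q./ 1) Q.+ -½ E Q.≤ (+ G) Q./ 1
S/2*x-½E≤G S x G E Sx≤2G+E = Q.*≤* (begin
  ((+ S ℤ.* + x) ℤ.* + 2 ℤ.+ ℤ.- + E ℤ.* + 2) ℤ.* + 1  ≡⟨ factor (+ S ℤ.* + x) (+ E) ⟩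
  (+ S ℤ.* + x ℤ.- + E) ℤ.* + 2                       ≤⟨ ℤ.*-monoʳ-≤-nonNeg (+ 2) (ℤ.+-monoˡ-≤ (ℤ.- + E) Sx≤2G+E′) ⟩
  (+ 2 ℤ.* + G ℤ.+ + E ℤ.- + E) ℤ.* + 2               ≡⟨ cancel (+ G) (+ E) ⟩
  + G ℤ.* + 4                                         ∎)
  where
  open ℤ.≤-Reasoning
  factor : ∀ y e → (y ℤ.* + 2 ℤ.+ ℤ.- e ℤ.* + 2) ℤ.* + 1 ≡ (y ℤ.- e) ℤ.* + 2
  factor = ℤ-Solver.solve-∀
  cancel : ∀ g e → (+ 2 ℤ.* g ℤ.+ e ℤ.- e) ℤ.* + 2 ≡ g ℤ.* + 4
  cancel = ℤ-Solver.solve-∀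
  Sx≤2G+E′ : + S ℤ.* + x ℤ.≤ + 2 ℤ.* + G ℤ.+ + E
  Sx≤2G+E′ = subst₂ ℤ._≤_ (ℤ.pos-* S x) (trans (ℤ.pos-+ (2 * G) E) (cong (ℤ._+ + E) (ℤ.pos-* 2 G)))
               (ℤ.+≤+ Sx≤2G+E)

∣-½∣≤ε* : ∀ E Y p d → E * suc d ≤ 2 * (suc p * Y) →
  Q.∣ -½ E ∣ Q.≤ Q.mkℚᵘ ℤ.+[1+ p ] d Q.* ((+ Y) Q./ 1)
∣-½∣≤ε* E Y p d E*[1+d]≤2*[1+p]*Y = Q.*≤* (subst₂ ℤ._≤_ lhs rhs (ℤ.+≤+ ineq))
  where
  ineq : E * (suc d * 1) ≤ suc p * Y * 2
  ineq = subst₂ _≤_ (cong (E *_) (sym (*-identityʳ (suc d)))) (*-comm 2 (suc p * Y)) E*[1+d]≤2*[1+p]*Y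
  lhs : + (E * (suc d * 1)) ≡ + ℤ.∣ ℤ.- + E ∣ ℤ.* + (suc d * 1)
  lhs = trans (ℤ.pos-* E (suc d * 1)) (cong (λ n → + n ℤ.* + (suc d * 1)) (sym (ℤ.∣-i∣≡∣i∣ (+ E))))
  rhs : + (suc p * Y * 2) ≡ (ℤ.+[1+ p ] ℤ.* + Y) ℤ.* + 2
  rhs = trans (ℤ.pos-* (suc p * Y) 2) (cong (ℤ._* + 2) (ℤ.pos-* (suc p) Y))

-½-shifted : (ℕ → ℕ) → ℕ → Q.ℚᵘ
-½-shifted f zero    = Q.0ℚᵘ
-½-shifted f (suc i) = -½ f i

-½-shifted-small : ∀ (f x : ℕ → ℕ) K → (∀ i → f i ≤ K * x (suc i)) → ∀ ε → Q.0ℚᵘ Q.< ε →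
  Σ ℕ λ N → ∀ n → N ≤ n → Q.∣ -½-shifted f n ∣ Q.≤ ε Q.* ((+ (n * x n)) Q./ 1)
-½-shifted-small f x K f≤Kx (Q.mkℚᵘ ℤ.+[1+ p ] d) _ = suc (K * suc d) , small
  where
  small : ∀ n → suc (K * suc d) ≤ n → Q.∣ -½-shifted f n ∣ Q.≤ Q.mkℚᵘ ℤ.+[1+ p ] d Q.* ((+ (n * x n)) Q./ 1)
  small (suc i) (s≤s K[1+d]≤i) = ∣-½∣≤ε* (f i) (suc i * x (suc i)) p d (begin
    f i * suc d                  ≤⟨ *-monoˡ-≤ (suc d) (f≤Kx i) ⟩
    K * x (suc i) * suc d        ≡⟨ swap K (x (suc i)) (suc d) ⟩
    K * suc d * x (suc i)        ≤⟨ *-monoˡ-≤ (x (suc i)) (m≤n⇒m≤1+n K[1+d]≤i) ⟩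
    suc i * x (suc i)            ≤⟨ m≤n*m (suc i * x (suc i)) (2 * suc p) ⟩
    2 * suc p * (suc i * x (suc i)) ≡⟨ *-assoc 2 (suc p) _ ⟩
    2 * (suc p * (suc i * x (suc i))) ∎)
    where
    open ≤-Reasoning
    swap : ∀ k y z → k * y * z ≡ k * z * y
    swap = solve-∀
-½-shifted-small f x K f≤Kx (Q.mkℚᵘ (+ 0) d) (Q.*<* (ℤ.+<+ ()))
-½-shifted-small f x K f≤Kx (Q.mkℚᵘ ℤ.-[1+ n ] d) (Q.*<* ())

lemma9 : (c : ℕ → ℕ) → InfiniteCoinSet c → InfCompletelyGreedy c →
    (Σ (ℕ → Q.ℚᵘ) λ e →
       (∀ ε → Q.0ℚᵘ Q.< ε → Σ ℕ λ N → ∀ n → N ≤ n →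
          Q.∣ e n ∣ Q.≤ ε Q.* ((+ (n * C c (suc n))) Q./ 1))
     × (∀ n → 1 ≤ n →
          ((+ s c n) Q./ 2) Q.* ((+ C c (suc n)) Q./ 1) Q.+ e n
            Q.≤ (+ cost c (C c (suc n) ∸ 1)) Q./ 1))
    × (∀ n → 1 ≤ n → (n ≤ s c n) × (⌈log₂ C c (suc n) ⌉ ≤ suc (s c n)))
lemma9 c (c0≡1 , c-inc) complete =
  (-½-shifted deficit , -½-shifted-small deficit c K deficit-≤-K*c , lower-bound) , s-bounds
  where
  open CoinSequence c0≡1 c-inc
  open Greedy complete

  lower-bound : ∀ n → 1 ≤ n → ((+ s c n) Q./ 2) Q.* ((+ c n) Q./ 1) Q.+ -½-shifted deficit n Q.≤ (+ cost c (c n ∸ 1)) Q./ 1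
  lower-bound (suc i) _ rewrite cost≡G i = S/2*x-½E≤G (s c (suc i)) (c (suc i)) (G i) (deficit i) (s*c≤2G+deficit i)

  s-bounds : ∀ n → 1 ≤ n → (n ≤ s c n) × (⌈log₂ c n ⌉ ≤ suc (s c n))
  s-bounds (suc i) _ = n≤s i , ≤-trans (⌈log₂⌉-mono-≤ (c≤2^[1+s] i)) (≤-reflexive (⌈log₂2^n⌉≡n (suc (s c (suc i)))))
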